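{- Let $G=(V,E)$ satisfy the standing assumptions, let $U$ be its maximum edge weight, and let $(C'[i],C[i],G[i])_{i\ge -1}$ be a valid hierarchy of $G$. For every integer $i$ with $i>\log_8 U$, the graph $IG[i]$ is connected.
   Context: Standing assumptions: $G$ is a finite connected undirected graph, edge weights at least $1$, shortest paths unique ($p(u,w)$, length $d(u,w)$), every edge is the shortest path between its endpoints. $B(v,r)=\{v': d(v,v')\le r\}$; $\mathrm{maxedge}(p)$ is the maximum edge weight on $p$. Shortcut graph $G(C,r)$: vertex set $C$, edge $\{v_1,v_2\}$ of weight $d(v_1,v_2)$ iff $d(v_1,v_2)\le r$ and $p(v_1,v_2)$ contains no element of $C$ besides $v_1,v_2$. Hierarchy: $E[i]$ ($i\ge -1$) is the set of edges of weight in $(8^{i-1},8^i]$, $E[\ge i]=\bigcup_{j\ge i}E[j]$. $C'[-1]=\emptyset$, $G[-1]$ empty; $C[i]=C'[i]\cup V(E[\ge i])$ for $i\ge -1$; $G[i]=G(C[i],8^i)$ for $i\ge0$. For $i\ge0$ a valid $C'[i]$ is obtained by: start with $\emptyset$; for each pair $v,v'\in V(G[i-1])$ (arbitrary order) with $d_{G[i-1]}(v,v')\in[\frac34 8^i,8^i]$ and $\mathrm{maxedge}(p_G(v,v'))\le 8^{i-1}$, if $p_{G[i-1]}(v,v')$ has no element of $C'[i]$, add the vertex of $G[i-1]$ on it closest to its midpoint. Ball covers: for $C\subseteq V$, $r>0$, $\mathrm{BallCover}(C,r)$ is a minimum-cardinality $C''\subseteq C$ with $C\subseteq\bigcup_{v\in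 C''}B(v,r)$. $BC[i]=\mathrm{BallCover}(C[i],8^i)$, and $IG[i]$ is the graph with vertex set $BC[i]$ and an edge $\{v_1,v_2\}$ whenever $v_1,v_2\in BC[i]$ and $d(v_1,v_2)\le 3\cdot 8^i$.
   Formalization: The edge weights of $G$ are rational numbers, so the distances and the maximum edge weight $U$ are rational as well. -}

module Defs where

open import Data.Nat as ℕ using (ℕ; zero; suc)
open import Data.Integer as ℤ using (ℤ; +_; -[1+_])
open import Data.Rational using (ℚ; _/_; 1ℚ; 0ℚ; ½; _*_; _+_; _-_; ∣_∣; _≤_; _<_; _⊔_)
open import Data.Fin using (Fin)
open import Data.Fin.Subset as Sub using (Subset; ⁅_⁆; _∪_)
open import Data.List using (List; []; _∷_; map)
open import Data.List.Membership.Propositional as L using ()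
open import Data.List.Relation.Unary.AllPairs using (AllPairs)
open import Data.Maybe using (Maybe; just; nothing)
open import Data.Product using (Σ; ∃; _×_; _,_)
open import Data.Sum using (_⊎_)
open import Data.Empty using (⊥)
open import Relation.Nullary using (¬_)
open import Relation.Binary.PropositionalEquality using (_≡_; _≢_)

pos8 : ℕ → ℚ
pos8 zero    = 1ℚ
pos8 (suc k) = (+ 8 / 1) * pos8 k

neg8 : ℕ → ℚ          -- neg8 k = 8^-(k+1)
neg8 zero    = + 1 / 8
neg8 (suc k) = (+ 1 / 8) * neg8 k

p8 : ℤ → ℚ
p8 (+ k)      = pos8 k
p8 -[1+ k ]   = neg8 k

-- Generic weighted (edge-relation) graphs on vertex set Fin n, walks.
-- An edge relation E u v x means: there is an edge {u,v} of weight x.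

EdgeRel : ℕ → Set₁
EdgeRel n = Fin n → Fin n → ℚ → Set

module _ {n : ℕ} (E : EdgeRel n) where

  data Walk : Fin n → Fin n → Set where
    []  : ∀ {u} → Walk u u
    step : ∀ {u v w} (x : ℚ) → E u v x → Walk v w → Walk u w

  len : ∀ {u v} → Walk u v → ℚ
  len []             = 0ℚ
  len (step x _ p)   = x + len p

  verts : ∀ {u v} → Walk u v → List (Fin n)
  verts {u} []           = u ∷ []
  verts {u} (step _ _ p) = u ∷ verts p

  positions : ∀ {u v} → Walk u v → List (Fin n × ℚ)
  positions {u} []           = (u , 0ℚ) ∷ []
  positions {u} (step x _ p) = (u , 0ℚ) ∷ map (λ { (y , m) → (y , x + m) }) (positions p)

  maxedge : ∀ {u v} → Walk u v → ℚ
  maxedge []           = 0ℚ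
  maxedge (step x _ p) = x ⊔ maxedge p

  IsShortest : ∀ {u v} → Walk u v → Set
  IsShortest {u} {v} p = ∀ (q : Walk u v) → len p ≤ len q

  Dist : Fin n → Fin n → ℚ → Set
  Dist u v x = Σ (Walk u v) λ p → IsShortest p × len p ≡ x

  ClosestToMid : ∀ {u v} → Walk u v → Fin n → Set
  ClosestToMid p x =
    Σ ℚ λ ℓ → ((x , ℓ) L.∈ positions p) ×
      (∀ y m → (y , m) L.∈ positions p → ∣ ℓ - ½ * len p ∣ ≤ ∣ m - ½ * len p ∣)

-- Base graph given by a weight function W (nothing = no edge).

EdgeOf : ∀ {n} → (Fin n → Fin n → Maybe ℚ) → EdgeRel n
EdgeOf W u v x = W u v ≡ just x

record Standing {n : ℕ} (W : Fin n → Fin n → Maybe ℚ) : Set where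
  field
    symmetric   : ∀ u v → W u v ≡ W v u
    noLoops     : ∀ u → W u u ≡ nothing
    weight≥1    : ∀ u v x → W u v ≡ just x → 1ℚ ≤ x
    connected   : ∀ u v → Walk (EdgeOf W) u v
    uniqueSP    : ∀ u v (p q : Walk (EdgeOf W) u v) →
                  IsShortest (EdgeOf W) p → IsShortest (EdgeOf W) q →
                  verts (EdgeOf W) p ≡ verts (EdgeOf W) q
    edgeIsSP    : ∀ u v x (e : W u v ≡ just x) →
                  IsShortest (EdgeOf W) (step x e [])

IsMaxWeight : ∀ {n} → (Fin n → Fin n → Maybe ℚ) → ℚ → Set
IsMaxWeight W U = (∃ λ u → ∃ λ v → W u v ≡ just U) × (∀ u v x → W u v ≡ just x → x ≤ U)

module Hierarchy {n : ℕ} (W : Fin n → Fin n → Maybe ℚ) (C' : ℤ → Subset n) where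

  EG : EdgeRel n
  EG = EdgeOf W

  d : Fin n → Fin n → ℚ → Set
  d = Dist EG

  Shortcut : (Fin n → Set) → ℚ → EdgeRel n
  Shortcut C r v₁ v₂ x =
    C v₁ × C v₂ × v₁ ≢ v₂ × d v₁ v₂ x × x ≤ r ×
    (∀ (P : Walk EG v₁ v₂) → IsShortest EG P →
       ∀ w → w L.∈ verts EG P → C w → w ≡ v₁ ⊎ w ≡ v₂)

  -- v ∈ V(E[≥ i]) : v is incident to an edge of weight > 8^(i-1)
  InVE≥ : ℤ → Fin n → Set
  InVE≥ i v = ∃ λ u → ∃ λ x → W v u ≡ just x × p8 (i ℤ.- ℤ.1ℤ) < x

  InC : ℤ → Fin n → Set
  InC i v = (v Sub.∈ C' i) ⊎ InVE≥ i v

  Gr : ℤ → EdgeRel n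
  Gr (+ k)        = Shortcut (InC (+ k)) (p8 (+ k))
  Gr -[1+ _ ]     = λ _ _ _ → ⊥

  VG : ℤ → Fin n → Set
  VG (+ k)    = InC (+ k)
  VG -[1+ _ ] = λ _ → ⊥

  Qualifies : (i : ℤ) → ∀ {v v'} → Walk (Gr (i ℤ.- ℤ.1ℤ)) v v' → Set
  Qualifies i {v} {v'} P =
    IsShortest (Gr (i ℤ.- ℤ.1ℤ)) P ×
    ((+ 3 / 4) * p8 i ≤ len (Gr (i ℤ.- ℤ.1ℤ)) P) × (len (Gr (i ℤ.- ℤ.1ℤ)) P ≤ p8 i) ×
    (∀ (Q : Walk EG v v') → IsShortest EG Q → maxedge EG Q ≤ p8 (i ℤ.- ℤ.1ℤ))

  -- Run i S L T : processing the pairs in L in order, starting from S, ends in T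
  data Run (i : ℤ) : Subset n → List (Fin n × Fin n) → Subset n → Set where
    done    : ∀ {S} → Run i S [] S
    skipNo  : ∀ {S v v' L T} →
              ¬ (Σ (Walk (Gr (i ℤ.- ℤ.1ℤ)) v v') (Qualifies i)) →
              Run i S L T → Run i S ((v , v') ∷ L) T
    skipHit : ∀ {S v v' L T} (P : Walk (Gr (i ℤ.- ℤ.1ℤ)) v v') → Qualifies i P →
              (∃ λ w → w L.∈ verts (Gr (i ℤ.- ℤ.1ℤ)) P × w Sub.∈ S) →
              Run i S L T → Run i S ((v , v') ∷ L) T
    add     : ∀ {S v v' L T} (P : Walk (Gr (i ℤ.- ℤ.1ℤ)) v v') → Qualifies i P →
              (∀ w → w L.∈ verts (Gr (i ℤ.- ℤ.1ℤ)) P → ¬ (w Sub.∈ S)) →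
              (x : Fin n) → ClosestToMid (Gr (i ℤ.- ℤ.1ℤ)) P x →
              Run i (⁅ x ⁆ ∪ S) L T → Run i S ((v , v') ∷ L) T

  SameUnordered : Fin n × Fin n → Fin n × Fin n → Set
  SameUnordered (a , b) (c , e) = (a ≡ c × b ≡ e) ⊎ (a ≡ e × b ≡ c)

  -- L lists every unordered pair of distinct vertices of V exactly once
  -- (in an arbitrary order and orientation)
  PairOrder : (Fin n → Set) → List (Fin n × Fin n) → Set
  PairOrder V L =
    (∀ v v' → V v → V v' → v ≢ v' → ((v , v') L.∈ L) ⊎ ((v' , v) L.∈ L)) ×
    (∀ v v' → (v , v') L.∈ L → V v × V v' × v ≢ v') ×
    AllPairs (λ p q → ¬ SameUnordered p q) L

  ValidLevel : ℤ → Set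
  ValidLevel i = Σ (List (Fin n × Fin n)) λ L →
    PairOrder (VG (i ℤ.- ℤ.1ℤ)) L × Run i Sub.⊥ L (C' i)

  Valid : Set
  Valid = (C' -[1+ 0 ] ≡ Sub.⊥) × (∀ (k : ℕ) → ValidLevel (+ k))

  IsBallCover : ℤ → Subset n → Set
  IsBallCover i B =
    (∀ v → v Sub.∈ B → InC i v) ×
    (∀ c → InC i c → ∃ λ v → v Sub.∈ B × ∃ λ x → d v c x × x ≤ p8 i)

  IsMinBallCover : ℤ → Subset n → Set
  IsMinBallCover i B =
    IsBallCover i B × (∀ B' → IsBallCover i B' → Sub.∣ B ∣ ℕ.≤ Sub.∣ B' ∣)

  IG : ℤ → Subset n → EdgeRel n
  IG i B v₁ v₂ x = v₁ Sub.∈ B × v₂ Sub.∈ B × d v₁ v₂ x × x ≤ (+ 3 / 1) * p8 i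

  ConnectedOn : Subset n → EdgeRel n → Set
  ConnectedOn B E = ∀ u v → u Sub.∈ B → v Sub.∈ B → Walk E u v

-- A C[k]-gap is a walk between two vertices of C[k] whose interior avoids C[k]. The heart of the
-- proof (ShortGaps) is that a shortest C[k]-gap whose edges all weigh at most 8^k has length at
-- most 8^k; this goes by induction on k. For k = 0 the gap is a single edge, because both ends of
-- an edge of weight ≥ 1 > 8^-1 lie in C[0]. Let p be a shortest C[k+1]-gap with at least two edges.
-- Each edge of p meets an interior vertex, so weighs at most 8^k. Since C[k+1] ⊆ C[k], the
-- induction hypothesis puts consecutive C[k]-vertices of p at most 8^k apart; so if p were longer
-- than 8^(k+1), it would contain strictly inside a stretch between C[k]-vertices w, y of length in
-- (6·8^k, 7·8^k]. That stretch is a shortest path of G[k] of length in [¾·8^(k+1), 8^(k+1)], so the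
-- pair (w, y) qualified when C'[k+1] was built and one of its vertices lies in C'[k+1] ⊆ C[k+1],
-- contradicting that p is a gap.
-- If U < 8^i, then i ≥ 0 (as U ≥ 1) and every edge weighs less than 8^i, so consecutive C[i]-vertices
-- of a shortest path between two ball centres are at most 8^i apart. Replacing each of them by a
-- centre covering it gives a walk in IG[i] whose steps have length at most 3·8^i.

module Submission where

open import Defs
open import Data.Nat as ℕ using (ℕ; zero; suc)
import Data.Nat.Properties as ℕₚ
open import Data.Integer as ℤ using (ℤ; +_; -[1+_])
import Data.Integer.Properties as ℤₚ
open import Data.Rational using (ℚ; mkℚ; 0ℚ; 1ℚ; _+_; _*_; -_; _/_; _≤_; _<_; ↥_; *≤*)
open import Data.Rational.Properties
open import Data.Rational.Solver using (module +-*-Solver)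
import Data.Rational.Unnormalised as ℚᵘ
import Data.Rational.Unnormalised.Properties as ℚᵘ
open import Data.Nat.Coprimality using (1-coprimeTo) renaming (sym to coprime-sym)
open import Data.Fin as Fin using (Fin)
open import Data.Fin.Properties using (any?)
open import Data.Fin.Subset as Sub using (Subset; ⁅_⁆)
open import Data.Fin.Subset.Properties using (_∈?_; ∉⊥; x∈⁅x⁆; x∈⁅y⁆⇒x≡y; p⊆p∪q; q⊆p∪q; x∈p∪q⁻)
open import Data.List using (List; []; _∷_; _++_)
open import Data.List.Membership.Propositional using (_∈_)
open import Data.List.Membership.Propositional.Properties using (∈-map⁻)
open import Data.List.Relation.Binary.Subset.Propositional using (_⊆_)
open import Data.List.Relation.Unary.All as All using (All; []; _∷_)
open import Data.List.Relation.Unary.All.Properties using (++⁻; anti-mono)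
open import Data.List.Relation.Unary.Any using (here; there)
open import Data.Maybe using (Maybe; just; nothing)
open import Data.Maybe.Properties using (just-injective)
open import Data.Product using (Σ; ∃; ∃₂; _×_; _,_; proj₁; proj₂; map₁; map₂)
open import Data.Sum using (_⊎_; inj₁; inj₂; [_,_]′)
open import Data.Empty using (⊥; ⊥-elim)
open import Data.Unit using (⊤; tt)
open import Function using (_∘_)
open import Relation.Nullary using (¬_; Dec; yes; no)
open import Relation.Nullary.Decidable using (toWitness; _⊎-dec_)
open import Relation.Unary using (Decidable)
open import Relation.Binary.PropositionalEquality
  using (_≡_; _≢_; refl; sym; trans; cong; cong₂; subst; subst₂; module ≡-Reasoning)
open import Algebra.Properties.Group +-0-group using (\\-leftDividesʳ; //-rightDividesʳ)

+-cancelˡ-≤ : ∀ r {p q} → r + p ≤ r + q → p ≤ q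
+-cancelˡ-≤ r {p} {q} h = subst₂ _≤_ (\\-leftDividesʳ r p) (\\-leftDividesʳ r q) (+-monoʳ-≤ (- r) h)

+-cancelˡ-< : ∀ r {p q} → r + p < r + q → p < q
+-cancelˡ-< r {p} {q} h = subst₂ _<_ (\\-leftDividesʳ r p) (\\-leftDividesʳ r q) (+-monoʳ-< (- r) h)

+-cancelʳ-< : ∀ r {p q} → p + r < q + r → p < q
+-cancelʳ-< r {p} {q} h = subst₂ _<_ (//-rightDividesʳ r p) (//-rightDividesʳ r q) (+-monoˡ-< (- r) h)

pos8-pos : ∀ k → 0ℚ < pos8 k
pos8-pos zero    = positive⁻¹ 1ℚ
pos8-pos (suc k) = *-monoʳ-<-pos (+ 8 / 1) (pos8-pos k)

pos8-nonneg : ∀ k → 0ℚ ≤ pos8 k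
pos8-nonneg k = <⇒≤ (pos8-pos k)

⅛<1 : + 1 / 8 < 1ℚ
⅛<1 = toWitness {a? = + 1 / 8 <? 1ℚ} tt

neg8≤1 : ∀ m → neg8 m ≤ 1ℚ
neg8≤1 zero    = <⇒≤ ⅛<1
neg8≤1 (suc m) = ≤-trans (*-monoˡ-≤-nonNeg (+ 1 / 8) (neg8≤1 m)) (<⇒≤ ⅛<1)

module _ where
  open +-*-Solver

  8a≡a+7a : ∀ a → (+ 8 / 1) * a ≡ a + (+ 7 / 1) * a
  8a≡a+7a = solve 1 (λ a → con (+ 8 / 1) :* a := a :+ con (+ 7 / 1) :* a) refl

  7a≡6a+a : ∀ a → (+ 7 / 1) * a ≡ (+ 6 / 1) * a + a
  7a≡6a+a = solve 1 (λ a → con (+ 7 / 1) :* a := con (+ 6 / 1) :* a :+ a) refl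

  ¾[8a]≡6a : ∀ a → (+ 3 / 4) * ((+ 8 / 1) * a) ≡ (+ 6 / 1) * a
  ¾[8a]≡6a = solve 1 (λ a → con (+ 3 / 4) :* (con (+ 8 / 1) :* a) := con (+ 6 / 1) :* a) refl

  3a≡a+[a+a] : ∀ a → (+ 3 / 1) * a ≡ a + (a + a)
  3a≡a+[a+a] = solve 1 (λ a → con (+ 3 / 1) :* a := a :+ (a :+ a)) refl

p≤p+q : ∀ p {q} → 0ℚ ≤ q → p ≤ p + q
p≤p+q p {q} 0≤q = subst (_≤ p + q) (+-identityʳ p) (+-monoʳ-≤ p 0≤q)

p≤q+p : ∀ {p} q → 0ℚ ≤ q → p ≤ q + p
p≤q+p {p} q 0≤q = subst (_≤ q + p) (+-identityˡ p) (+-monoˡ-≤ p 0≤q)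

7a≤8a : ∀ {a} → 0ℚ ≤ a → (+ 7 / 1) * a ≤ (+ 8 / 1) * a
7a≤8a {a} 0≤a = subst ((+ 7 / 1) * a ≤_) (sym (8a≡a+7a a)) (p≤q+p a 0≤a)

a≤3a : ∀ k → pos8 k ≤ (+ 3 / 1) * pos8 k
a≤3a k = subst (pos8 k ≤_) (sym (3a≡a+[a+a] (pos8 k))) (p≤p+q (pos8 k) (+-mono-≤ (pos8-nonneg k) (pos8-nonneg k)))

pos8-pred≤ : ∀ k → p8 (+ k ℤ.- ℤ.1ℤ) ≤ pos8 k
pos8-pred≤ zero    = <⇒≤ ⅛<1
pos8-pred≤ (suc k) = subst (pos8 k ≤_) (sym (8a≡a+7a (pos8 k)))
  (p≤p+q (pos8 k) (*-monoˡ-≤-nonNeg (+ 7 / 1) {0ℚ} (pos8-nonneg k)))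

fromℕ : ℕ → ℚ
fromℕ m = mkℚ (+ m) 0 (coprime-sym (1-coprimeTo m))

fromℕ-suc≤ : ∀ m → fromℕ (suc m) ≤ 1ℚ + fromℕ m
fromℕ-suc≤ m =
  toℚᵘ-cancel-≤ (ℚᵘ.≤-respʳ-≃ (ℚᵘ.≃-sym (toℚᵘ-homo-+ 1ℚ (fromℕ m))) (ℚᵘ.*≤* (ℤₚ.≤-reflexive eq)))
  where
  eq : + suc m ℤ.* (+ 1 ℤ.* + 1) ≡ (+ 1 ℤ.* + 1 ℤ.+ + m ℤ.* + 1) ℤ.* + 1
  eq = trans (ℤₚ.*-identityʳ _) (sym (trans (ℤₚ.*-identityʳ _) (cong (λ z → + 1 ℤ.+ z) (ℤₚ.*-identityʳ (+ m)))))

≤-fromℕ∣↥∣ : ∀ r → r ≤ fromℕ ℤ.∣ ↥ r ∣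
≤-fromℕ∣↥∣ (mkℚ (+ m) d _)    =
  *≤* (subst₂ ℤ._≤_ (ℤₚ.pos-* m 1) (ℤₚ.pos-* m (suc d)) (ℤ.+≤+ (ℕₚ.*-monoʳ-≤ m (ℕ.s≤s ℕ.z≤n))))
≤-fromℕ∣↥∣ (mkℚ -[1+ m ] d _) = *≤* ℤ.-≤+

module Walks {n : ℕ} (E : EdgeRel n) where

  infixr 5 _++ʷ_

  _++ʷ_ : ∀ {u v w} → Walk E u v → Walk E v w → Walk E u w
  []         ++ʷ q = q
  step x e p ++ʷ q = step x e (p ++ʷ q)

  len-++ʷ : ∀ {u v w} (p : Walk E u v) (q : Walk E v w) → len E (p ++ʷ q) ≡ len E p + len E q
  len-++ʷ []         q = sym (+-identityˡ _)
  len-++ʷ (step x e p) q = trans (cong (λ l → x + l) (len-++ʷ p q)) (sym (+-assoc x _ _))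

  ++ʷ-assoc : ∀ {u v w y} (p : Walk E u v) (q : Walk E v w) (r : Walk E w y) →
              (p ++ʷ q) ++ʷ r ≡ p ++ʷ (q ++ʷ r)
  ++ʷ-assoc []           q r = refl
  ++ʷ-assoc (step x e p) q r = cong (step x e) (++ʷ-assoc p q r)

  head∈verts : ∀ {u v} (p : Walk E u v) → u ∈ verts E p
  head∈verts []           = here refl
  head∈verts (step _ _ _) = here refl

  ∈-++ʷ⁺ʳ : ∀ {u v w} (p : Walk E u v) {q : Walk E v w} → verts E q ⊆ verts E (p ++ʷ q)
  ∈-++ʷ⁺ʳ []           z∈q = z∈q
  ∈-++ʷ⁺ʳ (step _ _ p) z∈q = there (∈-++ʷ⁺ʳ p z∈q)

  ∈-++ʷ⁻ : ∀ {u v w z} (p : Walk E u v) (q : Walk E v w) →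
           z ∈ verts E (p ++ʷ q) → z ∈ verts E p ⊎ z ∈ verts E q
  ∈-++ʷ⁻ []           q z∈q         = inj₂ z∈q
  ∈-++ʷ⁻ (step _ _ p) q (here refl) = inj₁ (here refl)
  ∈-++ʷ⁻ (step _ _ p) q (there z∈)  with ∈-++ʷ⁻ p q z∈
  ... | inj₁ z∈p = inj₁ (there z∈p)
  ... | inj₂ z∈q = inj₂ z∈q

  positions⊆verts : ∀ {u v z ℓ} (p : Walk E u v) → (z , ℓ) ∈ positions E p → z ∈ verts E p
  positions⊆verts []           (here refl) = here refl
  positions⊆verts (step _ _ p) (here refl) = here refl
  positions⊆verts (step _ _ p) (there z∈) with ∈-map⁻ _ z∈
  ... | _ , z∈p , refl = there (positions⊆verts p z∈p)

  shortest-++⁻ˡ : ∀ {u v w} (p : Walk E u v) (q : Walk E v w) → IsShortest E (p ++ʷ q) → IsShortest E p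
  shortest-++⁻ˡ p q sh p′ = +-cancelˡ-≤ (len E q) (subst₂ _≤_ (lemma p) (lemma p′) (sh (p′ ++ʷ q)))
    where
    lemma : ∀ (r : Walk E _ _) → len E (r ++ʷ q) ≡ len E q + len E r
    lemma r = trans (len-++ʷ r q) (+-comm (len E r) (len E q))

  shortest-++⁻ʳ : ∀ {u v w} (p : Walk E u v) (q : Walk E v w) → IsShortest E (p ++ʷ q) → IsShortest E q
  shortest-++⁻ʳ p q sh q′ = +-cancelˡ-≤ (len E p) (subst₂ _≤_ (len-++ʷ p q) (len-++ʷ p q′) (sh (p ++ʷ q′)))

  weights : ∀ {u v} → Walk E u v → List ℚ
  weights []           = []
  weights (step x _ p) = x ∷ weights p

  weights-++ʷ : ∀ {u v w} (p : Walk E u v) (q : Walk E v w) → weights (p ++ʷ q) ≡ weights p ++ weights q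
  weights-++ʷ []           q = refl
  weights-++ʷ (step x _ p) q = cong (x ∷_) (weights-++ʷ p q)

  EdgesAtMost : ℚ → ∀ {u v} → Walk E u v → Set
  EdgesAtMost c p = All (_≤ c) (weights p)

  edgesAtMost-++⁻ : ∀ {c u v w} (p : Walk E u v) (q : Walk E v w) →
                    EdgesAtMost c (p ++ʷ q) → EdgesAtMost c p × EdgesAtMost c q
  edgesAtMost-++⁻ p q h = ++⁻ (weights p) (subst (All _) (weights-++ʷ p q) h)

  maxedge-≤ : ∀ {c u v} (p : Walk E u v) → 0ℚ ≤ c → EdgesAtMost c p → maxedge E p ≤ c
  maxedge-≤ []           0≤c []          = 0≤c
  maxedge-≤ (step x e p) 0≤c (x≤c ∷ p≤c) = ⊔-lub x≤c (maxedge-≤ p 0≤c p≤c)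

  InitAvoids : (Fin n → Set) → ∀ {u v} → Walk E u v → Set
  InitAvoids C []               = ⊤
  InitAvoids C {u} (step _ _ p) = ¬ C u × InitAvoids C p

  Gap : (Fin n → Set) → ∀ {u v} → Walk E u v → Set
  Gap C []           = ⊥
  Gap C (step _ _ p) = InitAvoids C p

  initAvoids-last : ∀ {C u v z} (p : Walk E u v) → InitAvoids C p → z ∈ verts E p → C z → z ≡ v
  initAvoids-last []           _         (here refl) _  = refl
  initAvoids-last (step _ _ p) (¬Cu , _) (here refl) Cz = ⊥-elim (¬Cu Cz)
  initAvoids-last (step _ _ p) (_ , av)  (there z∈p) Cz = initAvoids-last p av z∈p Cz

  gap-ends : ∀ {C u v z} (p : Walk E u v) → Gap C p → z ∈ verts E p → C z → z ≡ u ⊎ z ≡ v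
  gap-ends (step _ _ p) _  (here refl) _  = inj₁ refl
  gap-ends (step _ _ p) av (there z∈p) Cz = inj₂ (initAvoids-last p av z∈p Cz)

  initAvoids-++⁻ʳ : ∀ {C u v w} (p : Walk E u v) (q : Walk E v w) → InitAvoids C (p ++ʷ q) → InitAvoids C q
  initAvoids-++⁻ʳ []           q av       = av
  initAvoids-++⁻ʳ (step _ _ p) q (_ , av) = initAvoids-++⁻ʳ p q av

  initAvoids-++⁻ˡ : ∀ {C u v v′ w x} (p : Walk E u v) (e : E v v′ x) (q : Walk E v′ w) →
                    InitAvoids C (p ++ʷ step x e q) → All (¬_ ∘ C) (verts E p)
  initAvoids-++⁻ˡ []           e q (¬Cv , _) = ¬Cv ∷ []
  initAvoids-++⁻ˡ (step _ _ p) e q (¬Cu , av) = ¬Cu ∷ initAvoids-++⁻ˡ p e q av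

  data GapSplit (C : Fin n → Set) : ∀ {u v} → Walk E u v → Set where
    end : ∀ {u} → GapSplit C ([] {u = u})
    gap : ∀ {u w v} (g : Walk E u w) (r : Walk E w v) →
          Gap C g → C w → GapSplit C r → GapSplit C (g ++ʷ r)

  gapSplit : ∀ {C} → Decidable C → ∀ {u v} → C v → (p : Walk E u v) → GapSplit C p
  gapSplit C? Cv []                  = end
  gapSplit C? Cv (step {v = w} x e p) with C? w | gapSplit C? Cv p
  ... | yes Cw | sp                          = gap (step x e []) p tt Cw sp
  ... | no ¬Cw | end                         = ⊥-elim (¬Cw Cv)
  ... | no ¬Cw | gap (step y f g) r av Cw′ sp = gap (step x e (step y f g)) r (¬Cw , av) Cw′ sp

module Graph {n : ℕ} {W : Fin n → Fin n → Maybe ℚ} (st : Standing W) where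
  open Standing st
  private
    G : EdgeRel n
    G = EdgeOf W
  open Walks G

  len-nonneg : ∀ {u v} (p : Walk G u v) → 0ℚ ≤ len G p
  len-nonneg []           = ≤-refl
  len-nonneg (step x e p) = subst (_≤ x + len G p) (+-identityˡ 0ℚ)
    (+-mono-≤ (≤-trans (nonNegative⁻¹ 1ℚ) (weight≥1 _ _ x e)) (len-nonneg p))

  1≤len-step : ∀ {u v w x} (e : W u v ≡ just x) (p : Walk G v w) → 1ℚ ≤ len G (step x e p)
  1≤len-step {x = x} e p = subst (_≤ x + len G p) (+-identityʳ 1ℚ) (+-mono-≤ (weight≥1 _ _ _ e) (len-nonneg p))

  edgesAtMost-bound : ∀ {c} → (∀ u v x → W u v ≡ just x → x ≤ c) → ∀ {u v} (p : Walk G u v) → EdgesAtMost c p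
  edgesAtMost-bound bound []           = []
  edgesAtMost-bound bound (step x e p) = bound _ _ x e ∷ edgesAtMost-bound bound p

  shortest-≢ : ∀ {u v} (p : Walk G u v) → IsShortest G p → 0ℚ < len G p → u ≢ v
  shortest-≢ p sh 0<p refl = <-irrefl refl (<-≤-trans 0<p (sh []))

  reverse : ∀ {u v} → Walk G u v → Walk G v u
  reverse []                         = []
  reverse (step {u = u} {v = v} x e p) = reverse p ++ʷ step x (trans (symmetric v u) e) []

  len-reverse : ∀ {u v} (p : Walk G u v) → len G (reverse p) ≡ len G p
  len-reverse []           = refl
  len-reverse (step x e p) = begin
    len G (reverse p ++ʷ step x _ [])  ≡⟨ len-++ʷ (reverse p) _ ⟩
    len G (reverse p) + (x + 0ℚ)       ≡⟨ cong₂ _+_ (len-reverse p) (+-identityʳ x) ⟩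
    len G p + x                        ≡⟨ +-comm (len G p) x ⟩
    x + len G p                        ∎
    where open ≡-Reasoning

  verts-reverse : ∀ {u v} (p : Walk G u v) → verts G (reverse p) ⊆ verts G p
  verts-reverse []           z∈ = z∈
  verts-reverse (step x e p) z∈ with ∈-++ʷ⁻ (reverse p) _ z∈
  ... | inj₁ z∈p             = there (verts-reverse p z∈p)
  ... | inj₂ (here refl)     = there (head∈verts p)
  ... | inj₂ (there (here refl)) = here refl

  reverse-shortest : ∀ {u v} (p : Walk G u v) → IsShortest G p → IsShortest G (reverse p)
  reverse-shortest p sh q = subst₂ _≤_ (sym (len-reverse p)) (len-reverse q) (sh (reverse q))

  -- The witness need not satisfy A itself, which makes Minorant antitone in A (minorant-⊆).
  Minorant : ∀ {u v} → (Walk G u v → Set) → Set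
  Minorant {u} {v} A = (Σ (Walk G u v) λ p → ∀ q → A q → len G p ≤ len G q) ⊎ (∀ q → ¬ A q)

  minorant-⊆ : ∀ {u v} {A B : Walk G u v → Set} → (∀ q → B q → A q) → Minorant A → Minorant B
  minorant-⊆ B⊆A (inj₁ (p , p≤)) = inj₁ (p , λ q → p≤ q ∘ B⊆A q)
  minorant-⊆ B⊆A (inj₂ none)     = inj₂ λ q → none q ∘ B⊆A q

  minorant-⊎ : ∀ {u v} {A B : Walk G u v → Set} → Minorant A → Minorant B → Minorant (λ q → A q ⊎ B q)
  minorant-⊎ (inj₂ noA) (inj₂ noB) = inj₂ λ { q (inj₁ a) → noA q a ; q (inj₂ b) → noB q b }
  minorant-⊎ (inj₁ (p , p≤)) (inj₂ noB) = inj₁ (p , λ { q (inj₁ a) → p≤ q a ; q (inj₂ b) → ⊥-elim (noB q b) })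
  minorant-⊎ (inj₂ noA) (inj₁ (p , p≤)) = inj₁ (p , λ { q (inj₁ a) → ⊥-elim (noA q a) ; q (inj₂ b) → p≤ q b })
  minorant-⊎ (inj₁ (p , p≤)) (inj₁ (p′ , p′≤)) with ≤-total (len G p) (len G p′)
  ... | inj₁ p≤p′ = inj₁ (p , λ { q (inj₁ a) → p≤ q a ; q (inj₂ b) → ≤-trans p≤p′ (p′≤ q b) })
  ... | inj₂ p′≤p = inj₁ (p′ , λ { q (inj₁ a) → ≤-trans p′≤p (p≤ q a) ; q (inj₂ b) → p′≤ q b })

  minorant-∃ : ∀ {u v m} (A : Fin m → Walk G u v → Set) → (∀ j → Minorant (A j)) → Minorant (λ q → ∃ λ j → A j q)
  minorant-∃ {m = zero}  A min = inj₂ λ { q (() , _) }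
  minorant-∃ {m = suc m} A min =
    minorant-⊆ split (minorant-⊎ (min Fin.zero) (minorant-∃ (A ∘ Fin.suc) (min ∘ Fin.suc)))
    where
    split : ∀ q → (∃ λ j → A j q) → A Fin.zero q ⊎ (∃ λ j → A (Fin.suc j) q)
    split q (Fin.zero  , a) = inj₁ a
    split q (Fin.suc j , a) = inj₂ (j , a)

  Trivial : ∀ {u v} → Walk G u v → Set
  Trivial []           = ⊤
  Trivial (step _ _ _) = ⊥

  data Through (K : ℕ) {u v : Fin n} (w : Fin n) : Walk G u v → Set where
    through : ∀ {x} (e : W u w ≡ just x) {q : Walk G w v} → len G q ≤ fromℕ K → Through K w (step x e q)

  minorant-trivial : ∀ u v → Minorant {u} {v} Trivial
  minorant-trivial u v with u Fin.≟ v
  ... | yes refl = inj₁ ([] , λ q _ → len-nonneg q)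
  ... | no u≢v   = inj₂ λ { [] _ → u≢v refl ; (step _ _ _) () }

  minorant-bounded : ∀ K u v → Minorant {u} {v} (λ q → len G q ≤ fromℕ K)
  minorant-bounded zero u v = minorant-⊆ empty (minorant-trivial u v)
    where
    empty : ∀ q → len G q ≤ 0ℚ → Trivial q
    empty []           _    = tt
    empty (step x e q) q≤0 = <-irrefl refl (<-≤-trans (positive⁻¹ 1ℚ) (≤-trans (1≤len-step e q) q≤0))
  minorant-bounded (suc K) u v =
    minorant-⊆ split (minorant-⊎ (minorant-trivial u v) (minorant-∃ (λ w → Through K w) minorant-through))
    where
    split : ∀ q → len G q ≤ fromℕ (suc K) → Trivial q ⊎ ∃ λ w → Through K w q
    split []           _ = inj₁ tt
    split (step x e q) q≤ = inj₂ (_ , through e (+-cancelˡ-≤ 1ℚ (≤-trans (+-monoˡ-≤ (len G q) (weight≥1 _ _ x e))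
                                                  (≤-trans q≤ (fromℕ-suc≤ K)))))
    minorant-through : ∀ w → Minorant (Through K w)
    minorant-through w with minorant-bounded K w v | W u w in eq
    ... | inj₂ none     | _       = inj₂ λ { (step _ _ q) (through _ q≤) → none q q≤ }
    ... | inj₁ _        | nothing = inj₂ λ { _ (through e _) → nothing≢just (trans (sym eq) e) }
      where
      nothing≢just : ∀ {x : ℚ} → nothing ≢ just x
      nothing≢just ()
    ... | inj₁ (p , p≤) | just x  = inj₁ (step x eq p , λ { (step _ _ q) (through e q≤) →
          subst (λ y → x + len G p ≤ y + len G q) (just-injective (trans (sym eq) e)) (+-monoʳ-≤ x (p≤ q q≤)) })

  shortest : ∀ u v → Σ (Walk G u v) (IsShortest G)
  shortest u v = from-minorant (minorant-bounded N u v)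
    where
    c : Walk G u v
    c = connected u v
    N : ℕ
    N = ℤ.∣ ↥ len G c ∣
    c≤N : len G c ≤ fromℕ N
    c≤N = ≤-fromℕ∣↥∣ (len G c)
    from-minorant : Minorant (λ q → len G q ≤ fromℕ N) → Σ (Walk G u v) (IsShortest G)
    from-minorant (inj₂ none)     = ⊥-elim (none c c≤N)
    from-minorant (inj₁ (p , p≤)) =
      p , λ q → [ p≤ q , ≤-trans (≤-trans (p≤ c c≤N) c≤N) ]′ (≤-total (len G q) (fromℕ N))

  dist : ∀ u v → ∃ (Dist G u v)
  dist u v with shortest u v
  ... | p , sh = len G p , p , sh , refl

  dist-sym : ∀ {u v x} → Dist G u v x → Dist G v u x
  dist-sym (p , sh , refl) = reverse p , reverse-shortest p sh , len-reverse p

  dist-triangle : ∀ {u v w x y z} → Dist G u v x → Dist G v w y → Dist G u w z → z ≤ x + y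
  dist-triangle (p , _ , refl) (q , _ , refl) (r , sh , refl) = subst (len G r ≤_) (len-++ʷ p q) (sh (p ++ʷ q))

module Levels {n : ℕ} {W : Fin n → Fin n → Maybe ℚ} (st : Standing W) (C′ : ℤ → Subset n) where
  open Standing st
  open Graph st
  open Hierarchy W C′
  open Walks EG

  C : ℕ → Fin n → Set
  C k = InC (+ k)

  Light : ℕ → Fin n → Set
  Light k z = ¬ InVE≥ (+ suc k) z

  heavy? : ∀ (c : ℚ) (m : Maybe ℚ) → Dec (∃ λ x → m ≡ just x × c < x)
  heavy? c nothing  = no λ { (_ , () , _) }
  heavy? c (just x) with c <? x
  ... | yes c<x = yes (x , refl , c<x)
  ... | no  c≮x = no λ { (_ , refl , c<x) → c≮x c<x }

  C? : ∀ k → Decidable (C k)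
  C? k z = (z ∈? C′ (+ k)) ⊎-dec any? (λ u → heavy? _ (W z u))

  ¬C⇒Light : ∀ {k z} → ¬ C (suc k) z → Light k z
  ¬C⇒Light ¬C heavy = ¬C (inj₂ heavy)

  light-weight : ∀ {k u v x} → Light k u → W u v ≡ just x → x ≤ pos8 k
  light-weight light e = ≮⇒≥ (λ a<x → light (_ , _ , e , a<x))

  light-edgesAtMost : ∀ {k u v} (p : Walk EG u v) → All (Light k) (verts EG p) → EdgesAtMost (pos8 k) p
  light-edgesAtMost []           _           = []
  light-edgesAtMost {k} (step x e p) (lu ∷ lp) = light-weight {k} lu e ∷ light-edgesAtMost {k} p lp

  initAvoids-edgesAtMost : ∀ {k u v} (p : Walk EG u v) → InitAvoids (C (suc k)) p → EdgesAtMost (pos8 k) p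
  initAvoids-edgesAtMost []           _          = []
  initAvoids-edgesAtMost {k} (step x e p) (¬Cu , av) = light-weight {k} (¬C⇒Light {k} ¬Cu) e ∷ initAvoids-edgesAtMost {k} p av

  flatten : ∀ {D r s t} (P : Walk (Shortcut D r) s t) → Σ (Walk EG s t) λ P′ →
            len EG P′ ≡ len (Shortcut D r) P × verts (Shortcut D r) P ⊆ verts EG P′
  flatten []                                         = [] , refl , λ z∈ → z∈
  flatten (step _ (_ , _ , _ , (g , _ , refl) , _) P) with flatten P
  ... | P′ , lP′ , P⊆P′ = g ++ʷ P′ , trans (len-++ʷ g P′) (cong (λ l → len EG g + l) lP′) ,
                          λ { (here refl) → head∈verts (g ++ʷ P′) ; (there z∈P) → ∈-++ʷ⁺ʳ g (P⊆P′ z∈P) }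

  shortcut-verts : ∀ {D r s t} → D s → (P : Walk (Shortcut D r) s t) → All D (verts (Shortcut D r) P)
  shortcut-verts Ds []                    = Ds ∷ []
  shortcut-verts Ds (step _ (_ , Dt , _) P) = Ds ∷ shortcut-verts Dt P

  OnQualifying : ℤ → Fin n → Set
  OnQualifying i z = ∃₂ λ v v′ → Σ (Walk (Gr (i ℤ.- ℤ.1ℤ)) v v′) λ P → Qualifies i P × z ∈ verts _ P

  run-mono : ∀ {i S L T z} → Run i S L T → z Sub.∈ S → z Sub.∈ T
  run-mono done                        z∈ = z∈
  run-mono (skipNo _ run)              z∈ = run-mono run z∈
  run-mono (skipHit _ _ _ run)         z∈ = run-mono run z∈
  run-mono (add {S = S} _ _ _ x _ run) z∈ = run-mono run (q⊆p∪q ⁅ x ⁆ S z∈)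

  run-⊆ : ∀ {i S L T z} → Run i S L T → z Sub.∈ T → z Sub.∈ S ⊎ OnQualifying i z
  run-⊆ done                 z∈ = inj₁ z∈
  run-⊆ (skipNo _ run)       z∈ = run-⊆ run z∈
  run-⊆ (skipHit _ _ _ run)  z∈ = run-⊆ run z∈
  run-⊆ {z = z} (add {S = S} P qual _ x (_ , x∈P , _) run) z∈ with run-⊆ run z∈
  ... | inj₂ onQ = inj₂ onQ
  ... | inj₁ z∈x∪S with x∈p∪q⁻ ⁅ x ⁆ S z∈x∪S
  ...   | inj₂ z∈S = inj₁ z∈S
  ...   | inj₁ z∈x =
    inj₂ (_ , _ , P , qual , subst (_∈ verts _ P) (sym (x∈⁅y⁆⇒x≡y x z∈x)) (Walks.positions⊆verts _ P x∈P))

  run-hit : ∀ {i S L T v v′} → Run i S L T → (v , v′) ∈ L → Σ (Walk (Gr (i ℤ.- ℤ.1ℤ)) v v′) (Qualifies i) →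
            Σ (Walk (Gr (i ℤ.- ℤ.1ℤ)) v v′) λ P → IsShortest _ P × ∃ λ z → z ∈ verts _ P × z Sub.∈ T
  run-hit (skipNo ¬qual _)           (here refl) qual = ⊥-elim (¬qual qual)
  run-hit (skipNo _ run)             (there vv′∈) qual = run-hit run vv′∈ qual
  run-hit (skipHit P (P-shortest , _) (z , z∈P , z∈S) run) (here refl) _ = P , P-shortest , z , z∈P , run-mono run z∈S
  run-hit (skipHit _ _ _ run)        (there vv′∈) qual = run-hit run vv′∈ qual
  run-hit (add {S = S} P (P-shortest , _) _ x (_ , x∈P , _) run) (here refl) _ =
    P , P-shortest , x , Walks.positions⊆verts _ P x∈P , run-mono run (p⊆p∪q S (x∈⁅x⁆ x))
  run-hit (add _ _ _ _ _ run)        (there vv′∈) qual = run-hit run vv′∈ qual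

  qualifying-verts : ∀ {k s t} (P : Walk (Gr (+ k)) s t) → Qualifies (+ suc k) P → All (C k) (verts (Gr (+ k)) P)
  qualifying-verts {k} [] (_ , 6a≤0 , _) =
    ⊥-elim (<-irrefl refl (<-≤-trans (*-monoʳ-<-pos (+ 6 / 1) (pos8-pos k)) (subst (_≤ 0ℚ) (¾[8a]≡6a (pos8 k)) 6a≤0)))
  qualifying-verts P@(step _ (Cs , _) _) _ = shortcut-verts Cs P

  C-suc⊆C : Valid → ∀ {k z} → C (suc k) z → C k z
  C-suc⊆C (_ , valid) {k} (inj₁ z∈C′) with run-⊆ (proj₂ (proj₂ (valid (suc k)))) z∈C′
  ... | inj₁ z∈⊥                     = ⊥-elim (∉⊥ z∈⊥)
  ... | inj₂ (_ , _ , P , qual , z∈P) = All.lookup (qualifying-verts P qual) z∈P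
  C-suc⊆C _ {k} (inj₂ (u , x , e , 8^k<x)) = inj₂ (u , x , e , ≤-<-trans (pos8-pred≤ k) 8^k<x)

  ShortGaps : ℕ → Set
  ShortGaps k = ∀ {s t} (g : Walk EG s t) → IsShortest EG g → C k s → C k t → Gap (C k) g →
                EdgesAtMost (pos8 k) g → len EG g ≤ pos8 k

  first-gap-≤ : ∀ {k s w t} → ShortGaps k → (g : Walk EG s w) (r : Walk EG w t) → IsShortest EG (g ++ʷ r) →
                C k s → C k w → Gap (C k) g → EdgesAtMost (pos8 k) (g ++ʷ r) → len EG g ≤ pos8 k
  first-gap-≤ short g r sh Cs Cw γ light =
    short g (shortest-++⁻ˡ g r sh) Cs Cw γ (proj₁ (edgesAtMost-++⁻ g r light))

  gap-edge : ∀ {k s t} → ShortGaps k → (g : Walk EG s t) → IsShortest EG g → C k s → C k t → Gap (C k) g →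
             EdgesAtMost (pos8 k) g → Gr (+ k) s t (len EG g)
  gap-edge short g@(step _ e g′) sh Cs Ct γ light =
    Cs , Ct , s≢t , (g , sh , refl) , short g sh Cs Ct γ light , only-ends
    where
    s≢t = shortest-≢ g sh (<-≤-trans (positive⁻¹ 1ℚ) (1≤len-step e g′))
    only-ends : ∀ (P : Walk EG _ _) → IsShortest EG P → ∀ w → w ∈ verts EG P → C _ w → w ≡ _ ⊎ w ≡ _
    only-ends P shP w w∈P Cw = gap-ends g γ (subst (w ∈_) (uniqueSP _ _ P g shP sh) w∈P) Cw

  shortcutWalk : ∀ {k s t} {q : Walk EG s t} → ShortGaps k → GapSplit (C k) q → IsShortest EG q → C k s →
                 EdgesAtMost (pos8 k) q → Σ (Walk (Gr (+ k)) s t) λ Q → len (Gr (+ k)) Q ≡ len EG q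
  shortcutWalk short end _ _ _ = [] , refl
  shortcutWalk short (gap g r γ Cw sp) sh Cs light
    with shortcutWalk short sp (shortest-++⁻ʳ g r sh) Cw (proj₂ (edgesAtMost-++⁻ g r light))
  ... | Q , lQ = step (len EG g) (gap-edge short g (shortest-++⁻ˡ g r sh) Cs Cw γ (proj₁ (edgesAtMost-++⁻ g r light))) Q ,
                 trans (cong (λ l → len EG g + l) lQ) (sym (len-++ʷ g r))

  Window : ℕ → ∀ {s t} → Walk EG s t → ℚ → ℚ → Set
  Window k {s} {t} r B T = Σ (Fin n) λ y → C k y × Σ (Walk EG s y) λ q → Σ (Walk EG y t) λ r₂ →
                           r ≡ q ++ʷ r₂ × B + len EG q ≤ T × T < B + len EG q + pos8 k

  window : ∀ {k s t} {r : Walk EG s t} → ShortGaps k → GapSplit (C k) r → IsShortest EG r → C k s →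
           EdgesAtMost (pos8 k) r → ∀ B T → B ≤ T → T < B + len EG r → Window k r B T
  window short end _ _ _ B T B≤T T<B+0 =
    ⊥-elim (<-irrefl refl (<-≤-trans T<B+0 (subst (_≤ T) (sym (+-identityʳ B)) B≤T)))
  window {k} {s} short (gap g r γ Cw sp) sh Cs light B T B≤T T< with T <? B + len EG g
  ... | yes T<B+g = s , Cs , [] , g ++ʷ r , refl , subst (_≤ T) (sym (+-identityʳ B)) B≤T ,
                    subst (λ b → T < b + pos8 k) (sym (+-identityʳ B))
                      (<-≤-trans T<B+g (+-monoʳ-≤ B (first-gap-≤ short g r sh Cs Cw γ light)))
  ... | no T≮B+g
    with window short sp (shortest-++⁻ʳ g r sh) Cw (proj₂ (edgesAtMost-++⁻ g r light)) (B + len EG g) T (≮⇒≥ T≮B+g)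
                (subst (T <_) (trans (cong (λ l → B + l) (len-++ʷ g r)) (sym (+-assoc B _ _))) T<)
  ...   | y , Cy , q , r₂ , refl , lo , hi =
          y , Cy , g ++ʷ q , r₂ , sym (++ʷ-assoc g q r₂) , subst (_≤ T) shift lo , subst (λ b → T < b + pos8 k) shift hi
    where
    shift : B + len EG g + len EG q ≡ B + len EG (g ++ʷ q)
    shift = trans (+-assoc B _ _) (cong (λ l → B + l) (sym (len-++ʷ g q)))


  stretch-qualifies : ∀ {k w y} (q : Walk EG w y) → IsShortest EG q → All (Light k) (verts EG q) →
                      (+ 6 / 1) * pos8 k < len EG q → len EG q ≤ (+ 7 / 1) * pos8 k →
                      (Q : Walk (Gr (+ k)) w y) → len (Gr (+ k)) Q ≡ len EG q → Qualifies (+ suc k) Q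
  stretch-qualifies {k} q sh light 6a< ≤7a Q lQ = Q-shortest , ¾8a≤Q , Q≤8a , maxedge≤8^k
    where
    Q-shortest : IsShortest (Gr (+ k)) Q
    Q-shortest R with flatten R
    ... | R′ , lR′ , _ = subst₂ _≤_ (sym lQ) lR′ (sh R′)
    ¾8a≤Q : (+ 3 / 4) * pos8 (suc k) ≤ len (Gr (+ k)) Q
    ¾8a≤Q = subst₂ _≤_ (sym (¾[8a]≡6a (pos8 k))) (sym lQ) (<⇒≤ 6a<)
    Q≤8a : len (Gr (+ k)) Q ≤ pos8 (suc k)
    Q≤8a = subst (_≤ pos8 (suc k)) (sym lQ) (≤-trans ≤7a (7a≤8a (pos8-nonneg k)))
    maxedge≤8^k : ∀ (Q₂ : Walk EG _ _) → IsShortest EG Q₂ → maxedge EG Q₂ ≤ pos8 k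
    maxedge≤8^k Q₂ sh₂ = maxedge-≤ Q₂ (pos8-nonneg k)
      (light-edgesAtMost {k} Q₂ (subst (All (Light k)) (sym (uniqueSP _ _ Q₂ q sh₂ sh)) light))

  shortcut-shortest-verts : ∀ {k w y} (q : Walk EG w y) → IsShortest EG q →
                            (Q : Walk (Gr (+ k)) w y) → len (Gr (+ k)) Q ≡ len EG q →
                            (P : Walk (Gr (+ k)) w y) → IsShortest (Gr (+ k)) P → verts (Gr (+ k)) P ⊆ verts EG q
  shortcut-shortest-verts q sh Q lQ P P-shortest {z} z∈P with flatten P
  ... | P′ , lP′ , P⊆P′ = subst (z ∈_) (uniqueSP _ _ P′ q P′-shortest sh) (P⊆P′ z∈P)
    where
    P′-shortest : IsShortest EG P′
    P′-shortest R = subst (_≤ len EG R) (sym lP′) (≤-trans (P-shortest Q) (subst (_≤ len EG R) (sym lQ) (sh R)))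

  listed-stretch-meets-C′ : (valid : Valid) → ∀ {k w y} → ShortGaps k → (q : Walk EG w y) → IsShortest EG q →
                            C k w → C k y → All (Light k) (verts EG q) →
                            (+ 6 / 1) * pos8 k < len EG q → len EG q ≤ (+ 7 / 1) * pos8 k →
                            (w , y) ∈ proj₁ (proj₂ valid (suc k)) → ∃ λ z → z ∈ verts EG q × z Sub.∈ C′ (+ suc k)
  listed-stretch-meets-C′ (_ , valid) {k} {w} {y} short q sh Cw Cy light 6a< ≤7a wy∈L
    with shortcutWalk {k} short (gapSplit (C? k) Cy q) sh Cw (light-edgesAtMost {k} q light)
  ... | Q , lQ = conclude (run-hit (proj₂ (proj₂ (valid (suc k)))) wy∈L (Q , stretch-qualifies {k} q sh light 6a< ≤7a Q lQ))
    where
    -- Not a `with`: abstracting over this term makes Agda normalise the arithmetic proofs inside it.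
    conclude : (Σ (Walk (Gr (+ k)) w y) λ P →
                 IsShortest (Gr (+ k)) P × ∃ λ z → z ∈ verts (Gr (+ k)) P × z Sub.∈ C′ (+ suc k)) →
               ∃ λ z → z ∈ verts EG q × z Sub.∈ C′ (+ suc k)
    conclude (P , P-shortest , z , z∈P , z∈C′) = z , shortcut-shortest-verts {k} q sh Q lQ P P-shortest z∈P , z∈C′

  stretch-meets-C′ : Valid → ∀ {k w y} → ShortGaps k → (q : Walk EG w y) → IsShortest EG q → C k w → C k y →
                     All (Light k) (verts EG q) →
                     (+ 6 / 1) * pos8 k < len EG q → len EG q ≤ (+ 7 / 1) * pos8 k →
                     ∃ λ z → z ∈ verts EG q × z Sub.∈ C′ (+ suc k)
  stretch-meets-C′ valid {k} {w} {y} short q sh Cw Cy light 6a< ≤7a =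
    [ listed-stretch-meets-C′ valid {k} short q sh Cw Cy light 6a< ≤7a , listed-reverse ]′
      (listed w y Cw Cy (shortest-≢ q sh (<-trans (*-monoʳ-<-pos (+ 6 / 1) (pos8-pos k)) 6a<)))
    where
    listed : ∀ v v′ → C k v → C k v′ → v ≢ v′ →
             (v , v′) ∈ proj₁ (proj₂ valid (suc k)) ⊎ (v′ , v) ∈ proj₁ (proj₂ valid (suc k))
    listed = proj₁ (proj₁ (proj₂ (proj₂ valid (suc k))))
    listed-reverse : (y , w) ∈ proj₁ (proj₂ valid (suc k)) → ∃ λ z → z ∈ verts EG q × z Sub.∈ C′ (+ suc k)
    listed-reverse yw∈L = map₂ (map₁ (verts-reverse q))
      (listed-stretch-meets-C′ valid {k} short (reverse q) (reverse-shortest q sh) Cy Cw (anti-mono (verts-reverse q) light)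
        (subst ((+ 6 / 1) * pos8 k <_) (sym (len-reverse q)) 6a<) (subst (_≤ (+ 7 / 1) * pos8 k) (sym (len-reverse q)) ≤7a) yw∈L)

  no-long-gap : Valid → ∀ {k u v} {p : Walk EG u v} → ShortGaps k → GapSplit (C k) p → IsShortest EG p → C k u →
                Gap (C (suc k)) p → EdgesAtMost (pos8 k) p → ¬ (pos8 (suc k) < len EG p)
  no-long-gap valid {k} short (gap g@(step _ _ g′) rest γₖ Cw sp) sh Cu γ light 8a<p =
    cut (window short sp rest-shortest Cw (proj₂ (edgesAtMost-++⁻ g rest light)) 0ℚ ((+ 7 / 1) * pos8 k) 0≤7a 7a<rest)
    where
    rest-shortest : IsShortest EG rest
    rest-shortest = shortest-++⁻ʳ g rest sh
    0≤7a : 0ℚ ≤ (+ 7 / 1) * pos8 k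
    0≤7a = *-monoˡ-≤-nonNeg (+ 7 / 1) {0ℚ} (pos8-nonneg k)
    7a<rest : (+ 7 / 1) * pos8 k < 0ℚ + len EG rest
    7a<rest = subst ((+ 7 / 1) * pos8 k <_) (sym (+-identityˡ (len EG rest))) (+-cancelˡ-< (pos8 k) (begin-strict
      pos8 k + (+ 7 / 1) * pos8 k  ≡⟨ sym (8a≡a+7a (pos8 k)) ⟩
      pos8 (suc k)                 <⟨ 8a<p ⟩
      len EG (g ++ʷ rest)          ≡⟨ len-++ʷ g rest ⟩
      len EG g + len EG rest       ≤⟨ +-monoˡ-≤ (len EG rest) (first-gap-≤ short g rest sh Cu Cw γₖ light) ⟩
      pos8 k + len EG rest         ∎))
      where open ≤-Reasoning
    cut : Window k rest 0ℚ ((+ 7 / 1) * pos8 k) → ⊥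
    cut (_ , _ , q , [] , eq , q≤7a , _) =
      <-irrefl refl (<-≤-trans 7a<rest (subst (_≤ (+ 7 / 1) * pos8 k) (cong (λ l → 0ℚ + l) q≡rest) q≤7a))
      where
      q≡rest : len EG q ≡ len EG rest
      q≡rest = sym (trans (cong (len EG) eq) (trans (len-++ʷ q []) (+-identityʳ (len EG q))))
    cut (y , Cy , q , step _ e₂ r₂ , eq , q≤7a , 7a<q+a) = All.lookup avoid z∈q (inj₁ z∈C′)
      where
      avoid : All (¬_ ∘ C (suc k)) (verts EG q)
      avoid = initAvoids-++⁻ˡ q e₂ r₂ (subst (InitAvoids (C (suc k))) eq (initAvoids-++⁻ʳ g′ rest γ))
      meets : ∃ λ z → z ∈ verts EG q × z Sub.∈ C′ (+ suc k)
      meets = stretch-meets-C′ valid {k} short q (shortest-++⁻ˡ q _ (subst (IsShortest EG) eq rest-shortest)) Cw Cy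
                (All.map (¬C⇒Light {k}) avoid)
                (+-cancelʳ-< (pos8 k) (subst₂ _<_ (7a≡6a+a (pos8 k)) (cong (_+ pos8 k) (+-identityˡ (len EG q))) 7a<q+a))
                (subst (_≤ (+ 7 / 1) * pos8 k) (+-identityˡ (len EG q)) q≤7a)
      z∈q = proj₁ (proj₂ meets)
      z∈C′ = proj₂ (proj₂ meets)

  single-edge-≤ : ∀ {c u v x} (e : W u v ≡ just x) → EdgesAtMost c (step x e []) → len EG (step x e []) ≤ c
  single-edge-≤ {x = x} _ (x≤c ∷ []) = subst (_≤ _) (sym (+-identityʳ x)) x≤c

  shortGaps : Valid → ∀ k → ShortGaps k
  shortGaps valid zero (step x e []) _ _ _ _ light = single-edge-≤ e light
  shortGaps valid zero (step x e (step y f q)) _ _ _ (¬Ct , _) _ =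
    ⊥-elim (¬Ct (inj₂ (_ , y , f , <-≤-trans ⅛<1 (weight≥1 _ _ y f))))
  shortGaps valid (suc k) (step x e []) _ _ _ _ light = single-edge-≤ e light
  shortGaps valid (suc k) p@(step {v = s} x e (step y f q)) sh Cu Cv γ@(¬Cs , _) _ with len EG p ≤? pos8 (suc k)
  ... | yes p≤ = p≤
  ... | no  p≰ = ⊥-elim (no-long-gap valid {k} (shortGaps valid k) (gapSplit (C? k) (C-suc⊆C valid Cv) p) sh (C-suc⊆C valid Cu)
                   γ light (≰⇒> p≰))
    where
    light : EdgesAtMost (pos8 k) p
    light = light-weight {k} (¬C⇒Light {k} ¬Cs) (trans (symmetric s _) e) ∷ initAvoids-edgesAtMost {k} (step y f q) γ

  ballCover-walk : ∀ {k B c v} {p : Walk EG c v} → ShortGaps k → IsBallCover (+ k) B → GapSplit (C k) p →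
                   IsShortest EG p → C k c → EdgesAtMost (pos8 k) p → v Sub.∈ B →
                   ∀ {b x} → b Sub.∈ B → Dist EG b c x → x ≤ pos8 k → Walk (IG (+ k) B) b v
  ballCover-walk {k} short cover end _ _ _ v∈B {x = x} b∈B b-c x≤a =
    step x (b∈B , v∈B , b-c , ≤-trans x≤a (a≤3a k)) []
  ballCover-walk {k} short cover (gap g r γ Cw sp) sh Cc light v∈B {b} {x} b∈B b-c x≤a with proj₂ cover _ Cw
  ... | b′ , b′∈B , x′ , b′-w , x′≤a with dist b b′ | dist _ b′
  ...   | z , b-b′ | y , c-b′ =
          step z (b∈B , b′∈B , b-b′ , z≤3a)
            (ballCover-walk short cover sp (shortest-++⁻ʳ g r sh) Cw (proj₂ (edgesAtMost-++⁻ g r light))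
               v∈B b′∈B b′-w x′≤a)
    where
    z≤3a : z ≤ (+ 3 / 1) * pos8 k
    z≤3a = begin
      z                           ≤⟨ dist-triangle b-c c-b′ b-b′ ⟩
      x + y                       ≤⟨ +-monoʳ-≤ x (dist-triangle (g , shortest-++⁻ˡ g r sh , refl) (dist-sym b′-w) c-b′) ⟩
      x + (len EG g + x′)         ≤⟨ +-mono-≤ x≤a (+-mono-≤ (first-gap-≤ short g r sh Cc Cw γ light) x′≤a) ⟩
      pos8 k + (pos8 k + pos8 k)  ≡⟨ sym (3a≡a+[a+a] (pos8 k)) ⟩
      (+ 3 / 1) * pos8 k          ∎
      where open ≤-Reasoning

  IG-connected : ∀ {k U B} → ShortGaps k → (∀ u v x → W u v ≡ just x → x ≤ U) → U < pos8 k →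
                 IsBallCover (+ k) B → ConnectedOn B (IG (+ k) B)
  IG-connected {k} short maxU U<a cover u v u∈B v∈B =
    ballCover-walk short cover (gapSplit (C? k) (proj₁ cover v v∈B) p) p-shortest (proj₁ cover u u∈B)
      (edgesAtMost-bound (λ u v x e → <⇒≤ (≤-<-trans (maxU u v x e) U<a)) p) v∈B u∈B
      ([] , len-nonneg , refl) (pos8-nonneg k)
    where
    p = proj₁ (shortest u v)
    p-shortest = proj₂ (shortest u v)

mainTheorem9 : ∀ {n : ℕ} (W : Fin n → Fin n → Maybe ℚ) → Standing W →
    ∀ (U : ℚ) → IsMaxWeight W U →
    ∀ (C' : ℤ → Subset n) → Hierarchy.Valid W C' →
    ∀ (i : ℤ) → U < p8 i →
    ∀ (BC : Subset n) → Hierarchy.IsMinBallCover W C' i BC →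
    Hierarchy.ConnectedOn W C' BC (Hierarchy.IG W C' i BC)
mainTheorem9 W st U ((u , v , e) , _) C' valid -[1+ m ] U<8^i BC _ =
  ⊥-elim (<-irrefl refl (<-≤-trans U<8^i (≤-trans (neg8≤1 m) (Standing.weight≥1 st u v U e))))
mainTheorem9 W st U (_ , maxU) C' valid (+ k) U<8^k BC (cover , _) =
  Levels.IG-connected st C' (Levels.shortGaps st C' valid k) maxU U<8^k cover
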